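{- The canonical simplicial model $\mathcal{C}^c=(C^c,\chi^c,l^c)$ is a simplicial model.
   Context: Agents $\mathcal{A}$ finite, $|\mathcal{A}|=n+1$; propositional variables $P=\bigsqcup_{a\in\mathcal{A}}P_a$, $P_a$ pairwise disjoint, countable. A simplicial model is $(C,\chi,l)$ with $C\neq\emptyset$ a collection of nonempty finite subsets of a vertex set $V$, downward closed under nonempty subsets; $\chi:V\to\mathcal{A}$ such that each simplex has at most one vertex of each colour; $l:V\to 2^P$ with $l(v)\subseteq P_{\chi(v)}$. Language $\mathcal{L}^{DSL}$: $\varphi::=p_a\mid\neg\varphi\mid(\varphi\wedge\varphi)\mid\mathbf{D}_G\varphi$ ($G\subseteq\mathcal{A}$). DSL axioms: propositional tautologies; K: $\mathbf{D}_G(\varphi\rightarrow\psi)\rightarrow(\mathbf{D}_G\varphi\rightarrow\mathbf{D}_G\psi)$; T: $\mathbf{D}_G\varphi\rightarrow\varphi$; 4: $\mathbf{D}_G\varphi\rightarrow\mathbf{D}_G\mathbf{D}_G\varphi$; N: $\varphi\rightarrow\mathbf{D}_G\varphi$ for at least one $G$; WN: $\neg p_a\rightarrow\mathbf{D}_{\{a\}}\neg p_a$, $p_a\rightarrow\mathbf{D}_{\{a\}}p_a$; rule MP. Maximal consistent sets are taken w.r.t. DSL; $\mathcal{G}$ is the set of all maximal consistent sets. For a set $\Gamma$, $\mathbf{D}_{\{a\}}\Gamma:=\{\mathbf{D}_{\{a\}}\varphi\mid\varphi\in\Gamma\}$. For $\Gamma\in\mathcal{G}$ let $X_\Gamma:=\{\mathbf{D}_{\{a\}}\Gamma\mid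 a\in\mathcal{A},\ \mathbf{D}_{\{a\}}\Gamma\neq\emptyset\}$. The canonical simplicial model is: $C^c=\{X\mid \exists\Gamma\in\mathcal{G}:\ \emptyset\neq X\subseteq X_\Gamma\}$, with vertex set $V^c=\bigcup_{X\in C^c}X$; $\chi^c(\mathbf{D}_{\{a\}}\Gamma)=a$; $l^c(\mathbf{D}_{\{a\}}\Gamma)=\{p_a\in P_a\mid\mathbf{D}_{\{a\}}p_a\in\mathbf{D}_{\{a\}}\Gamma\}$. -}

module Defs where

open import Level using (Level; 0ℓ; _⊔_) renaming (suc to lsuc)
open import Data.Nat using (ℕ; zero; suc)
open import Data.Fin using (Fin)
import Data.Fin
open import Data.Fin.Subset using (Subset; ⁅_⁆; inside; outside)
open import Data.Bool using (Bool; true; false; not; _∧_)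
open import Data.Vec using ([]; _∷_)
open import Data.List using (List; []; _∷_; map; _++_)
open import Data.List.Relation.Unary.All using (All)
open import Data.List.Relation.Unary.Any using (Any)
open import Data.Product using (Σ; ∃; _×_; proj₁; _,_)
open import Relation.Binary using (Rel)
open import Relation.Binary.PropositionalEquality using (_≡_)
open import Relation.Nullary using (¬_)
open import Relation.Unary using (Pred; _⊆_; _≐_; _∪_; ｛_｝)

-- Agents: 𝒜 = Fin (suc n), so |𝒜| = n+1.
-- Propositional variables: P_a = { (a , k) | k : ℕ } (countably infinite,
-- pairwise disjoint).

Agent : ℕ → Set
Agent n = Fin (suc n)

PropVar : ℕ → Set
PropVar n = Σ (Agent n) (λ _ → ℕ)

owner : ∀ {n} → PropVar n → Agent n
owner = proj₁

-- U : ambient type of "objects", _≈_ : the equality on them (a setoid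
-- equality, e.g. extensional equality of sets), V : the vertex set,
-- C : collection of simplices (subsets of U), χ and l are defined on
-- vertices (taking the membership proof as argument) and must be
-- well defined w.r.t. _≈_.

record IsSimplicialModel {u e ℓv ℓc : Level} (n : ℕ) {U : Set u}
         (_≈_ : Rel U e) (V : Pred U ℓv) (C : Pred (Pred U 0ℓ) ℓc)
         (χ : (v : U) → V v → Agent n)
         (l : (v : U) → V v → Pred (PropVar n) 0ℓ)
         : Set (lsuc (u ⊔ e ⊔ ℓv ⊔ ℓc)) where
  field
    C-nonempty       : Σ (Pred U 0ℓ) C
    simplex-nonempty : ∀ {X} → C X → Σ U X
    simplex-finite   : ∀ {X} → C X →
                       Σ (List U) (λ vs → ∀ {v} → X v → Any (v ≈_) vs)
    simplex-⊆V       : ∀ {X} → C X → X ⊆ V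
    downward-closed  : ∀ {X Y : Pred U 0ℓ} → C X → Σ U Y → Y ⊆ X → C Y
    χ-wd             : ∀ {v w} (p : V v) (q : V w) → v ≈ w → χ v p ≡ χ w q
    χ-proper         : ∀ {X} → C X → ∀ {v w} → X v → X w →
                       (p : V v) (q : V w) → χ v p ≡ χ w q → v ≈ w
    l-wd             : ∀ {v w} (p : V v) (q : V w) → v ≈ w → l v p ≐ l w q
    l-colour         : ∀ {v} (p : V v) {x} → l v p x → owner x ≡ χ v p

infixr 6 _∧'_
infix 7 ¬'_

data Form (n : ℕ) : Set where
  var  : (a : Agent n) → ℕ → Form n
  ¬'_  : Form n → Form n
  _∧'_ : Form n → Form n → Form n
  D    : Subset (suc n) → Form n → Form n

module _ {n : ℕ} where

  infixr 4 _⇒_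
  infixr 5 _∨'_

  _⇒_ : Form n → Form n → Form n
  φ ⇒ ψ = ¬' (φ ∧' ¬' ψ)

  _∨'_ : Form n → Form n → Form n
  φ ∨' ψ = ¬' (¬' φ ∧' ¬' ψ)

  ⊥' : Form n
  ⊥' = var Data.Fin.zero 0 ∧' ¬' var Data.Fin.zero 0

  ⋁ : List (Form n) → Form n
  ⋁ []       = ⊥'
  ⋁ (φ ∷ φs) = φ ∨' ⋁ φs

  eval : (Form n → Bool) → Form n → Bool
  eval v (var a k) = v (var a k)
  eval v (¬' φ)    = not (eval v φ)
  eval v (φ ∧' ψ)  = eval v φ ∧ eval v ψ
  eval v (D G φ)   = v (D G φ)

  Taut : Form n → Set
  Taut φ = ∀ (v : Form n → Bool) → eval v φ ≡ true

allSubsets : ∀ m → List (Subset m)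
allSubsets zero    = [] ∷ []
allSubsets (suc m) = map (inside ∷_) (allSubsets m) ++ map (outside ∷_) (allSubsets m)

data ⊢_ {n : ℕ} : Form n → Set where
  taut : ∀ {φ} → Taut φ → ⊢ φ
  axK  : ∀ {G φ ψ} → ⊢ (D G (φ ⇒ ψ) ⇒ (D G φ ⇒ D G ψ))
  axT  : ∀ {G φ} → ⊢ (D G φ ⇒ φ)
  ax4  : ∀ {G φ} → ⊢ (D G φ ⇒ D G (D G φ))
  axN  : ∀ {φ} → ⊢ (φ ⇒ ⋁ (map (λ G → D G φ) (allSubsets (suc n))))
  axWN¬ : ∀ {a k} → ⊢ (¬' var a k ⇒ D ⁅ a ⁆ (¬' var a k))
  axWN  : ∀ {a k} → ⊢ (var a k ⇒ D ⁅ a ⁆ (var a k))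
  mp   : ∀ {φ ψ} → ⊢ (φ ⇒ ψ) → ⊢ φ → ⊢ ψ

module _ {n : ℕ} where

  _⇒*_ : List (Form n) → Form n → Form n
  [] ⇒* φ       = φ
  (ψ ∷ ψs) ⇒* φ = ψ ⇒ (ψs ⇒* φ)

  _⊢'_ : Pred (Form n) 0ℓ → Form n → Set
  Γ ⊢' φ = Σ (List (Form n)) (λ ψs → All Γ ψs × ⊢ (ψs ⇒* φ))

  Consistent : Pred (Form n) 0ℓ → Set
  Consistent Γ = ¬ Σ (Form n) (λ φ → (Γ ⊢' φ) × (Γ ⊢' (¬' φ)))

  MaxCons : Pred (Form n) 0ℓ → Set
  MaxCons Γ = Consistent Γ × (∀ φ → Consistent (Γ ∪ ｛ φ ｝) → Γ φ)

  D[_]_ : Agent n → Pred (Form n) 0ℓ → Pred (Form n) 0ℓ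
  (D[ a ] Γ) ψ = Σ (Form n) (λ φ → Γ φ × ψ ≡ D ⁅ a ⁆ φ)

  -- X_Γ = { D_{a}Γ | a ∈ 𝒜, D_{a}Γ ≠ ∅ }  (set membership up to set equality)
  XΓ : Pred (Form n) 0ℓ → Pred (Pred (Form n) 0ℓ) 0ℓ
  XΓ Γ S = Σ (Agent n) (λ a → (S ≐ D[ a ] Γ) × Σ (Form n) (D[ a ] Γ))

  Cc : Pred (Pred (Pred (Form n) 0ℓ) 0ℓ) (lsuc 0ℓ)
  Cc X = Σ (Pred (Form n) 0ℓ) (λ Γ → MaxCons Γ × Σ (Pred (Form n) 0ℓ) X × X ⊆ XΓ Γ)

  Vc : Pred (Pred (Form n) 0ℓ) (lsuc 0ℓ)
  Vc S = Σ (Pred (Pred (Form n) 0ℓ) 0ℓ) (λ X → Cc X × X S)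

  -- χ^c(D_{a}Γ) = a  (read off the representation of the vertex)
  χc : (S : Pred (Form n) 0ℓ) → Vc S → Agent n
  χc S (X , (Γ , _ , _ , X⊆) , XS) = proj₁ (X⊆ XS)

  lc : (S : Pred (Form n) 0ℓ) → Vc S → Pred (PropVar n) 0ℓ
  lc S p (b , k) = (b ≡ χc S p) × S (D ⁅ b ⁆ (var b k))

-- C^c is nonempty because DSL is sound for the one-world model in which every atom is
-- false and every D_G is the identity: the formulas true there form a maximal
-- consistent set. A vertex S ≐ D_{a}Γ contains some D_{a}φ, from which the colour a can
-- be read off; so χ^c is well defined, and two vertices of a simplex inside X_Γ with the
-- same colour a are both D_{a}Γ. A simplex is finite since X_Γ lists at most one vertex
-- per agent.
module Submission where

open import Defs
open import Data.Nat using (ℕ; suc)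
open import Data.Bool using (Bool; true; false; not; _∧_)
open import Data.Bool.Properties using (∧-zeroʳ; ∧-inverseʳ)
open import Data.Empty using (⊥; ⊥-elim)
open import Data.Fin using (zero)
open import Data.Fin.Subset using (⁅_⁆; ⊤; inside) renaming (_∈_ to _∈ₛ_)
open import Data.Fin.Subset.Properties using (x∈⁅x⁆; x∈⁅y⁆⇒x≡y)
open import Data.List using ([]; _∷_; map; allFin)
open import Data.List.Membership.Propositional using (_∈_)
open import Data.List.Membership.Propositional.Properties using (∈-map⁺; ∈-++⁺ˡ; ∈-allFin)
open import Data.List.Relation.Unary.All using (All; []; _∷_)
open import Data.List.Relation.Unary.Any as Any using (Any; here; there)
open import Data.List.Relation.Unary.Any.Properties using (map⁺)
open import Data.Product using (Σ; _×_; _,_; proj₁; proj₂)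
open import Data.Sum using (inj₁; inj₂)
import Data.Vec as Vec
open import Level using (0ℓ)
open import Relation.Binary.PropositionalEquality using (_≡_; refl; sym; trans; cong; cong₂; subst)
open import Relation.Unary using (Pred; _⊆_; _≐_; _∪_; ｛_｝)
open import Relation.Unary.Properties using (≐-refl; ≐-sym; ≐-trans)

module _ {n : ℕ} where

  ⟦_⟧ : Form n → Bool
  ⟦ var a k ⟧ = false
  ⟦ ¬' φ ⟧    = not ⟦ φ ⟧
  ⟦ φ ∧' ψ ⟧  = ⟦ φ ⟧ ∧ ⟦ ψ ⟧
  ⟦ D G φ ⟧   = ⟦ φ ⟧

  ⊨_ : Pred (Form n) 0ℓ
  ⊨ φ = ⟦ φ ⟧ ≡ true

  eval-⟦⟧ : ∀ φ → eval ⟦_⟧ φ ≡ ⟦ φ ⟧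
  eval-⟦⟧ (var a k) = refl
  eval-⟦⟧ (¬' φ)    = cong not (eval-⟦⟧ φ)
  eval-⟦⟧ (φ ∧' ψ)  = cong₂ _∧_ (eval-⟦⟧ φ) (eval-⟦⟧ ψ)
  eval-⟦⟧ (D G φ)   = refl

  ⊨-⇒-intro : ∀ φ ψ → (⊨ φ → ⊨ ψ) → ⊨ (φ ⇒ ψ)
  ⊨-⇒-intro φ ψ f with ⟦ φ ⟧ | ⟦ ψ ⟧ | f
  ... | false | _     | _ = refl
  ... | true  | true  | _ = refl
  ... | true  | false | f = f refl

  ⊨-⇒-elim : ∀ {φ ψ} → ⊨ (φ ⇒ ψ) → ⊨ φ → ⊨ ψ
  ⊨-⇒-elim {φ} {ψ} with ⟦ φ ⟧ | ⟦ ψ ⟧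
  ... | true  | true  = λ _ _ → refl
  ... | true  | false = λ φ⇒ψ _ → φ⇒ψ
  ... | false | _     = λ _ ()

  ⊨-contradiction : ∀ {φ} → ⊨ φ → ⊨ (¬' φ) → ⊥
  ⊨-contradiction ⊨φ ⊨¬φ rewrite ⊨φ with ⊨¬φ
  ... | ()

  ⊨-⋁ : ∀ {ψ ψs} → ψ ∈ ψs → ⊨ ψ → ⊨ (⋁ ψs)
  ⊨-⋁ (here refl) ⊨ψ rewrite ⊨ψ = refl
  ⊨-⋁ {ψs = φ ∷ _} (there ψ∈) ⊨ψ rewrite ⊨-⋁ ψ∈ ⊨ψ | ∧-zeroʳ (not ⟦ φ ⟧) = refl

  ⊤∈allSubsets : ∀ m → ⊤ ∈ allSubsets m
  ⊤∈allSubsets 0       = here refl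
  ⊤∈allSubsets (suc m) = ∈-++⁺ˡ (∈-map⁺ (inside Vec.∷_) (⊤∈allSubsets m))

  ⊢-sound : ∀ {φ} → ⊢ φ → ⊨ φ
  ⊢-sound {φ} (taut t) = trans (sym (eval-⟦⟧ φ)) (t ⟦_⟧)
  ⊢-sound (axK {G} {φ} {ψ}) = ⊨-⇒-intro (D G (φ ⇒ ψ)) (D G φ ⇒ D G ψ) λ h → h
  ⊢-sound (axT {G} {φ}) = ⊨-⇒-intro (D G φ) φ λ h → h
  ⊢-sound (ax4 {G} {φ}) = ⊨-⇒-intro (D G φ) (D G (D G φ)) λ h → h
  ⊢-sound (axN {φ}) = ⊨-⇒-intro φ (⋁ (map (λ G → D G φ) (allSubsets (suc n))))
                        (⊨-⋁ (∈-map⁺ (λ G → D G φ) (⊤∈allSubsets (suc n))))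
  ⊢-sound axWN¬ = refl
  ⊢-sound axWN = refl
  ⊢-sound (mp {φ} {ψ} d e) = ⊨-⇒-elim {φ} {ψ} (⊢-sound d) (⊢-sound e)

  ⊢'-sound : ∀ {Γ φ} → Γ ⊆ ⊨_ → Γ ⊢' φ → ⊨ φ
  ⊢'-sound {Γ} Γ⊨ (ψs , Γψs , d) = ⇒*-elim Γψs (⊢-sound d)
    where
    ⇒*-elim : ∀ {φ ψs} → All Γ ψs → ⊨ (ψs ⇒* φ) → ⊨ φ
    ⇒*-elim [] ⊨φ = ⊨φ
    ⇒*-elim {φ} {ψ ∷ ψs} (Γψ ∷ Γψs) ⊨ψ⇒φ = ⇒*-elim Γψs (⊨-⇒-elim {ψ} {ψs ⇒* φ} ⊨ψ⇒φ (Γ⊨ Γψ))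

  ⊢'-assumption : ∀ {Γ : Pred (Form n) 0ℓ} {φ} → Γ φ → Γ ⊢' φ
  ⊢'-assumption {φ = φ} Γφ = φ ∷ [] , Γφ ∷ [] , taut λ v → cong not (∧-inverseʳ (eval v φ))

  ⊨-maxCons : MaxCons ⊨_
  ⊨-maxCons = consistent , maximal
    where
    consistent : Consistent ⊨_
    consistent (φ , ⊢φ , ⊢¬φ) = ⊨-contradiction {φ} (⊢'-sound (λ h → h) ⊢φ) (⊢'-sound (λ h → h) ⊢¬φ)

    maximal : ∀ φ → Consistent (⊨_ ∪ ｛ φ ｝) → ⊨ φ
    maximal φ cons with ⟦ φ ⟧ in ⟦φ⟧≡
    ... | true  = refl
    ... | false = ⊥-elim (cons (φ , ⊢'-assumption (inj₂ refl) , ⊢'-assumption (inj₁ ⊨¬φ)))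
      where
      ⊨¬φ : ⊨ (¬' φ)
      ⊨¬φ = cong not ⟦φ⟧≡

  D-injectiveˡ : ∀ {G H} {φ ψ : Form n} → D G φ ≡ D H ψ → G ≡ H
  D-injectiveˡ refl = refl

  ⁅⁆-injective : ∀ {a b : Agent n} → ⁅ a ⁆ ≡ ⁅ b ⁆ → a ≡ b
  ⁅⁆-injective {a} {b} eq = x∈⁅y⁆⇒x≡y b (subst (a ∈ₛ_) eq (x∈⁅x⁆ a))

  D[]-agent-unique : ∀ {a b Γ Δ} → Σ (Form n) (D[ a ] Γ) → D[ a ] Γ ⊆ D[ b ] Δ → a ≡ b
  D[]-agent-unique (_ , ψ∈) D[a]Γ⊆ with ψ∈ | D[a]Γ⊆ ψ∈
  ... | _ , _ , refl | _ , _ , eq = ⁅⁆-injective (D-injectiveˡ eq)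

  Vc-shape : ∀ {S} (p : Vc S) →
             Σ (Pred (Form n) 0ℓ) λ Γ → (S ≐ D[ χc S p ] Γ) × Σ (Form n) (D[ χc S p ] Γ)
  Vc-shape (_ , (Γ , _ , _ , X⊆XΓ) , S∈X) = Γ , proj₂ (X⊆XΓ S∈X)

  χc-agent : ∀ {S a Γ} (p : Vc S) → S ≐ D[ a ] Γ → Σ (Form n) (D[ a ] Γ) → χc S p ≡ a
  χc-agent p S≐ nonempty with Vc-shape p
  ... | _ , S≐′ , _ = sym (D[]-agent-unique nonempty (proj₁ (≐-trans (≐-sym S≐) S≐′)))

  χc-wd : ∀ {v w} (p : Vc v) (q : Vc w) → v ≐ w → χc v p ≡ χc w q
  χc-wd p q v≐w with Vc-shape q
  ... | _ , w≐ , nonempty = χc-agent p (≐-trans v≐w w≐) nonempty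

  χc-proper : ∀ {X} → Cc X → ∀ {v w} → X v → X w →
              (p : Vc v) (q : Vc w) → χc v p ≡ χc w q → v ≐ w
  χc-proper (Γ , _ , _ , X⊆XΓ) v∈X w∈X p q χ≡ with X⊆XΓ v∈X | X⊆XΓ w∈X
  ... | a , v≐ , nonemptyᵥ | b , w≐ , nonemptyʷ =
    ≐-trans v≐ (subst (λ c → D[ c ] Γ ≐ _) b≡a (≐-sym w≐))
    where
    b≡a : b ≡ a
    b≡a = trans (sym (χc-agent q w≐ nonemptyʷ)) (trans (sym χ≡) (χc-agent p v≐ nonemptyᵥ))

  lc-wd : ∀ {v w} (p : Vc v) (q : Vc w) → v ≐ w → lc v p ≐ lc w q
  lc-wd p q v≐w@(v⊆w , w⊆v) =
    (λ (b≡ , v∋) → trans b≡ (χc-wd p q v≐w) , v⊆w v∋) ,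
    (λ (b≡ , w∋) → trans b≡ (χc-wd q p (≐-sym v≐w)) , w⊆v w∋)

  XΓ-listed : ∀ {Γ S} → XΓ Γ S → Any (S ≐_) (map (λ b → D[ b ] Γ) (allFin (suc n)))
  XΓ-listed (a , S≐ , _) = map⁺ (Any.map (λ { refl → S≐ }) (∈-allFin a))

  XΓ-simplex : ∀ {Γ} → MaxCons Γ → Σ (Form n) Γ → Cc (XΓ Γ)
  XΓ-simplex {Γ} Γ-max (φ , Γφ) = Γ , Γ-max , (D[ zero ] Γ , zero , ≐-refl , (_ , φ , Γφ , refl)) , λ h → h

mainTheorem4 : (n : ℕ) → IsSimplicialModel n _≐_ (Vc {n}) (Cc {n}) (χc {n}) (lc {n})
mainTheorem4 n = record
  { C-nonempty       = _ , XΓ-simplex ⊨-maxCons (¬' var zero 0 , refl)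
  ; simplex-nonempty = λ (_ , _ , nonempty , _) → nonempty
  ; simplex-finite   = λ (_ , _ , _ , X⊆XΓ) → _ , λ v∈X → XΓ-listed (X⊆XΓ v∈X)
  ; simplex-⊆V       = λ X∈C v∈X → _ , X∈C , v∈X
  ; downward-closed  = λ (Γ , Γ-max , _ , X⊆XΓ) nonempty Y⊆X → Γ , Γ-max , nonempty , λ y → X⊆XΓ (Y⊆X y)
  ; χ-wd             = χc-wd
  ; χ-proper         = χc-proper
  ; l-wd             = lc-wd
  ; l-colour         = λ _ → proj₁
  }
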